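{- Every Decision Polyamorous Scheduling instance $\mathcal{P}_d=(P,R,f)$ with poly density $d\le \frac14$ is schedulable, i.e. admits a valid schedule.
   Context: A Decision Polyamorous Scheduling (DPS) instance $\mathcal P_d=(P,R,f)$ consists of a finite simple undirected graph $(P,R)$ and integer frequencies $f:R\to\mathbb N$ (write $f_e=f(e)$). A schedule is a function $S:\mathbb N_0\to 2^R$. For $e\in R$, the recurrence time $r_S(e)$ is the supremum of $d+1$ over all $d\in\mathbb N$ for which there exists $t\in\mathbb N_0$ with $e\notin S(t)\cup\dots\cup S(t+d-1)$ (and $r_S(e)=1$ if no such $d$ exists). A schedule is valid for $\mathcal P_d$ if $S(t)$ is a matching of $(P,R)$ for every $t\in\mathbb N_0$ and $r_S(e)\le f(e)$ for all $e\in R$. Let $\mathcal M$ be the set of inclusion-maximal matchings of $(P,R)$ and $\mathcal Z$ the set of weightings $z:R\to[0,1]$ with $\sum_{e\in R} z_e=1$. The poly density of $\mathcal P_d$ is $d=\max_{z\in\mathcal Z} \left(\max_{M\in\mathcal M}\sum_{e\in M} z_e f_e\right)^{ -1}$. -}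

module Defs where

open import Data.Nat as ℕ using (ℕ; zero; suc; _+_)
open import Data.Fin using (Fin; zero; suc; toℕ)
open import Data.Bool using (Bool; true; false; if_then_else_)
open import Data.Product using (_×_; _,_; proj₁; proj₂; Σ; ∃)
open import Data.Sum using (_⊎_)
open import Data.Rational as ℚ using (ℚ; 0ℚ; 1ℚ)
open import Relation.Binary.PropositionalEquality using (_≡_; _≢_)
open import Data.Integer using (+_)
open import Relation.Nullary using (¬_)

-- A finite simple undirected graph (P,R): P = Fin n, R indexed by Fin m;
-- edge e joins endpoints (proj₁ (edge e)) < (proj₂ (edge e)), edges pairwise distinct.
record Graph : Set where
  field
    n     : ℕ
    m     : ℕ
    edge  : Fin m → Fin n × Fin n
    ordered   : ∀ e → toℕ (proj₁ (edge e)) ℕ.< toℕ (proj₂ (edge e))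
    injective : ∀ e e' → edge e ≡ edge e' → e ≡ e'

open Graph public

record DPS : Set where
  field
    graph : Graph
    freq  : Fin (m graph) → ℕ

open DPS public

EdgeSet : Graph → Set
EdgeSet G = Fin (m G) → Bool

Adjacent : (G : Graph) → Fin (m G) → Fin (m G) → Set
Adjacent G e e' =
  (proj₁ (edge G e) ≡ proj₁ (edge G e')) ⊎ (proj₁ (edge G e) ≡ proj₂ (edge G e')) ⊎
  (proj₂ (edge G e) ≡ proj₁ (edge G e')) ⊎ (proj₂ (edge G e) ≡ proj₂ (edge G e'))

IsMatching : (G : Graph) → EdgeSet G → Set
IsMatching G M = ∀ e e' → M e ≡ true → M e' ≡ true → e ≢ e' → ¬ Adjacent G e e'

IsMaximalMatching : (G : Graph) → EdgeSet G → Set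
IsMaximalMatching G M =
  IsMatching G M ×
  (∀ (M' : EdgeSet G) → IsMatching G M' → (∀ e → M e ≡ true → M' e ≡ true) →
     ∀ e → M' e ≡ true → M e ≡ true)

Schedule : Graph → Set
Schedule G = ℕ → EdgeSet G

-- r_S(e) ≤ f, unfolded: every d for which some window S(t),…,S(t+d-1) misses e
-- satisfies d+1 ≤ f (d = 0 always qualifies, giving the default value 1).
RecurrenceAtMost : (G : Graph) → Schedule G → Fin (m G) → ℕ → Set
RecurrenceAtMost G S e f =
  ∀ (d t : ℕ) → (∀ i → i ℕ.< d → S (t + i) e ≡ false) → suc d ℕ.≤ f

ValidSchedule : (I : DPS) → Schedule (graph I) → Set
ValidSchedule I S =
  (∀ t → IsMatching (graph I) (S t)) ×
  (∀ e → RecurrenceAtMost (graph I) S e (freq I e))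

Schedulable : DPS → Set
Schedulable I = Σ (Schedule (graph I)) (ValidSchedule I)

natℚ : ℕ → ℚ
natℚ k = (+ k) ℚ./ 1

sumℚ : (m : ℕ) → (Fin m → ℚ) → ℚ
sumℚ zero    g = 0ℚ
sumℚ (suc m) g = g zero ℚ.+ sumℚ m (λ i → g (suc i))

IsWeighting : (G : Graph) → (Fin (m G) → ℚ) → Set
IsWeighting G z = (∀ e → 0ℚ ℚ.≤ z e) × (∀ e → z e ℚ.≤ 1ℚ) × (sumℚ (m G) z ≡ 1ℚ)

matchingValue : (I : DPS) → (Fin (m (graph I)) → ℚ) → EdgeSet (graph I) → ℚ
matchingValue I z M =
  sumℚ (m (graph I)) (λ e → if M e then z e ℚ.* (natℚ (freq I e)) else 0ℚ)

-- poly density d ≤ 1/4, unfolded: for every weighting z, the max over maximal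
-- matchings M of Σ_{e∈M} z_e f_e is at least 4 (i.e. its reciprocal is ≤ 1/4).
PolyDensityAtMostQuarter : DPS → Set
PolyDensityAtMostQuarter I =
  ∀ (z : Fin (m (graph I)) → ℚ) → IsWeighting (graph I) z →
    ∃ λ (M : EdgeSet (graph I)) →
      IsMaximalMatching (graph I) M × (natℚ 4 ℚ.≤ matchingValue I z M)

{-# OPTIONS --safe #-}
-- Round every frequency f_e down to a power of two 2^ℓ_e and give the edge e a
-- binary word of length ℓ_e; e is served at the times whose ℓ_e least
-- significant binary digits spell its word, so at least once in every 2^ℓ_e ≤ f_e
-- consecutive steps, and two edges are served together only if one word is a
-- prefix of the other.  It remains to make the words of adjacent edges
-- prefix-free.  Choose them greedily in order of increasing length: by Kraft's
-- argument a word for e = uv exists as long as, at u and at v, the sum of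
-- 2^-ℓ_e' over the edges e' already coded is below 1/2.  That is what density
-- ≤ 1/4 gives when tested on the weighting proportional to 2^-ℓ_e' on the edges e'
-- at u with ℓ_e' ≤ ℓ_e: a matching contains at most one of them, and each has
-- 2^-ℓ_e' f_e' < 2.
module Submission where

open import Data.Bool using (true; false; if_then_else_)
open import Data.Bool.Properties using (not-¬)
open import Data.Empty using (⊥-elim)
open import Data.Fin as Fin using (Fin; zero; suc; toℕ)
import Data.Fin.Properties as FinP
import Data.Integer as ℤ
import Data.Integer.Properties as ℤP
open import Data.List using (List; []; _∷_; length)
open import Data.List.Properties using (≡-dec)
open import Data.List.Relation.Binary.Prefix.Heterogeneous using (Prefix; []; _∷_)
open import Data.Maybe using (Maybe; just; nothing)
open import Data.Nat as ℕ
  using (ℕ; zero; suc; _+_; _*_; _∸_; _^_; _≤_; _<_; z≤n; s≤s; _≤?_; _<?_; parity; ⌊_/2⌋)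
import Data.Nat.Coprimality as Coprimality
import Data.Nat.Properties as ℕP
open import Algebra.Properties.CommutativeMonoid.Sum ℕP.+-0-commutativeMonoid
  using (sum; sum-cong-≗; sum-replicate-zero; ∑-distrib-+)
open import Algebra.Properties.CommutativeSemigroup ℕP.+-commutativeSemigroup using (x∙yz≈y∙xz)
open import Data.Parity.Base using (Parity; 0ℙ; 1ℙ)
import Data.Parity.Properties as ℙP
open import Data.Product using (_×_; _,_; proj₁; proj₂; ∃)
open import Data.Rational as ℚ using (ℚ; mkℚ; 0ℚ; 1ℚ; _/_; 1/_)
import Data.Rational.Properties as ℚP
open import Data.Sum using (_⊎_; inj₁; inj₂)
open import Function using (_∘_)
open import Relation.Binary.Definitions using (tri<; tri≈; tri>)
open import Relation.Binary.PropositionalEquality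
open import Relation.Nullary using (¬_; Dec; yes; no; does)
open import Relation.Nullary.Decidable using (dec-true; _×-dec_; _⊎-dec_)

open import Defs

natℚ≡mkℚ : ∀ k → natℚ k ≡ mkℚ (ℤ.+ k) 0 (Coprimality.sym (Coprimality.1-coprimeTo k))
natℚ≡mkℚ k = ℚP.normalize-coprime (Coprimality.sym (Coprimality.1-coprimeTo k))

natℚ-homo-+ : ∀ a b → natℚ (a + b) ≡ natℚ a ℚ.+ natℚ b
natℚ-homo-+ a b rewrite natℚ≡mkℚ a | natℚ≡mkℚ b =
  cong (_/ 1) (sym (cong₂ ℤ._+_ (ℤP.*-identityʳ (ℤ.+ a)) (ℤP.*-identityʳ (ℤ.+ b))))

natℚ-homo-* : ∀ a b → natℚ (a * b) ≡ natℚ a ℚ.* natℚ b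
natℚ-homo-* a b rewrite natℚ≡mkℚ a | natℚ≡mkℚ b = cong (_/ 1) (ℤP.pos-* a b)

natℚ-mono-≤ : ∀ {a b} → a ≤ b → natℚ a ℚ.≤ natℚ b
natℚ-mono-≤ {a} {b} a≤b rewrite natℚ≡mkℚ a | natℚ≡mkℚ b =
  ℚ.*≤* (ℤP.*-monoʳ-≤-nonNeg (ℤ.+ 1) (ℤ.+≤+ a≤b))

natℚ-cancel-≤ : ∀ {a b} → natℚ a ℚ.≤ natℚ b → a ≤ b
natℚ-cancel-≤ {a} {b} le rewrite natℚ≡mkℚ a | natℚ≡mkℚ b =
  ℤP.drop‿+≤+ (subst₂ ℤ._≤_ (ℤP.*-identityʳ (ℤ.+ a)) (ℤP.*-identityʳ (ℤ.+ b)) (ℚP.drop-*≤* le))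

*-cancel-inverse : ∀ c w x → c ℚ.* w ≡ 1ℚ → c ℚ.* x ℚ.* w ≡ x
*-cancel-inverse c w x cw≡1 = begin
  c ℚ.* x ℚ.* w     ≡⟨ ℚP.*-assoc c x w ⟩
  c ℚ.* (x ℚ.* w)   ≡⟨ cong (c ℚ.*_) (ℚP.*-comm x w) ⟩
  c ℚ.* (w ℚ.* x)   ≡⟨ ℚP.*-assoc c w x ⟨
  c ℚ.* w ℚ.* x     ≡⟨ cong (ℚ._* x) cw≡1 ⟩
  1ℚ ℚ.* x          ≡⟨ ℚP.*-identityˡ x ⟩
  x                 ∎
  where open ≡-Reasoning

sumℚ-cong : ∀ n {g h : Fin n → ℚ} → (∀ i → g i ≡ h i) → sumℚ n g ≡ sumℚ n h
sumℚ-cong zero    g≗h = refl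
sumℚ-cong (suc n) g≗h = cong₂ ℚ._+_ (g≗h zero) (sumℚ-cong n (g≗h ∘ suc))

sumℚ-scale-natℚ : ∀ n c (g : Fin n → ℕ) → sumℚ n (λ i → c ℚ.* natℚ (g i)) ≡ c ℚ.* natℚ (sum g)
sumℚ-scale-natℚ zero    c g = sym (ℚP.*-zeroʳ c)
sumℚ-scale-natℚ (suc n) c g = begin
  c ℚ.* natℚ (g zero) ℚ.+ sumℚ n (λ i → c ℚ.* natℚ (g (suc i)))
    ≡⟨ cong (c ℚ.* natℚ (g zero) ℚ.+_) (sumℚ-scale-natℚ n c (g ∘ suc)) ⟩
  c ℚ.* natℚ (g zero) ℚ.+ c ℚ.* natℚ (sum (g ∘ suc))
    ≡⟨ ℚP.*-distribˡ-+ c _ _ ⟨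
  c ℚ.* (natℚ (g zero) ℚ.+ natℚ (sum (g ∘ suc)))
    ≡⟨ cong (c ℚ.*_) (natℚ-homo-+ (g zero) _) ⟨
  c ℚ.* natℚ (sum g) ∎
  where open ≡-Reasoning

sum-mono-≤ : ∀ {n} {g h : Fin n → ℕ} → (∀ i → g i ≤ h i) → sum g ≤ sum h
sum-mono-≤ {zero}  g≤h = z≤n
sum-mono-≤ {suc n} g≤h = ℕP.+-mono-≤ (g≤h zero) (sum-mono-≤ (g≤h ∘ suc))

≤-sum : ∀ {n} (g : Fin n → ℕ) i → g i ≤ sum g
≤-sum g zero    = ℕP.m≤m+n (g zero) _
≤-sum g (suc i) = ℕP.≤-trans (≤-sum (g ∘ suc) i) (ℕP.m≤n+m _ (g zero))

sum<-singleSupport : ∀ {n} (g : Fin n → ℕ) {B} → 0 < B → (∀ i → g i < B) →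
                     (∀ i j → g i ≢ 0 → g j ≢ 0 → i ≡ j) → sum g < B
sum<-singleSupport {zero}  g 0<B g<B single = 0<B
sum<-singleSupport {suc n} g {B} 0<B g<B single with g zero ℕ.≟ 0
... | yes g₀≡0 rewrite g₀≡0 =
  sum<-singleSupport (g ∘ suc) 0<B (g<B ∘ suc)
    (λ i j gᵢ≢0 gⱼ≢0 → FinP.suc-injective (single (suc i) (suc j) gᵢ≢0 gⱼ≢0))
... | no g₀≢0 =
  subst (λ r → g zero + r < B) (sym rest≡0) (subst (_< B) (sym (ℕP.+-identityʳ (g zero))) (g<B zero))
  where
  vanish : ∀ i → g (suc i) ≡ 0
  vanish i with g (suc i) ℕ.≟ 0
  ... | yes gᵢ≡0 = gᵢ≡0
  ... | no  gᵢ≢0 with single zero (suc i) g₀≢0 gᵢ≢0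
  ... | ()
  rest≡0 : sum (g ∘ suc) ≡ 0
  rest≡0 = trans (sum-cong-≗ vanish) (sum-replicate-zero n)

indicator : ∀ {n} → Fin n → Fin n → ℕ
indicator i j with i Fin.≟ j
... | yes _ = 1
... | no  _ = 0

indicator-self : ∀ {n} (i : Fin n) → indicator i i ≡ 1
indicator-self i with i Fin.≟ i
... | yes _   = refl
... | no  i≢i = ⊥-elim (i≢i refl)

m≤n⇒2*m≤m+n : ∀ {m n} → m ≤ n → 2 * m ≤ m + n
m≤n⇒2*m≤m+n {m} m≤n = ℕP.+-monoʳ-≤ m (ℕP.≤-trans (ℕP.≤-reflexive (ℕP.+-identityʳ m)) m≤n)

2*m<o∧2*n<o⇒m+n<o : ∀ {m n o} → 2 * m < o → 2 * n < o → m + n < o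
2*m<o∧2*n<o⇒m+n<o {m} {n} {o} 2m<o 2n<o = ℕP.*-cancelˡ-< 2 (m + n) o (begin-strict
  2 * (m + n)      ≡⟨ ℕP.*-distribˡ-+ 2 m n ⟩
  2 * m + 2 * n    <⟨ ℕP.+-mono-< 2m<o 2n<o ⟩
  o + o            ≡⟨ cong (o +_) (ℕP.+-identityʳ o) ⟨
  2 * o            ∎)
  where open ℕP.≤-Reasoning

m<n∧δ≤1⇒m*2+δ<2*n : ∀ {m n δ} → m < n → δ ≤ 1 → m * 2 + δ < 2 * n
m<n∧δ≤1⇒m*2+δ<2*n {m} {n} {δ} m<n δ≤1 = begin-strict
  m * 2 + δ    ≤⟨ ℕP.+-monoʳ-≤ (m * 2) δ≤1 ⟩
  m * 2 + 1    <⟨ ℕP.+-monoʳ-< (m * 2) (ℕP.n<1+n 1) ⟩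
  m * 2 + 2    ≡⟨ ℕP.+-comm (m * 2) 2 ⟩
  suc m * 2    ≤⟨ ℕP.*-monoˡ-≤ 2 m<n ⟩
  n * 2        ≡⟨ ℕP.*-comm n 2 ⟩
  2 * n        ∎
  where open ℕP.≤-Reasoning

2^[n∸m]*2^[1+m]≡2^[1+n] : ∀ {m n} → m ≤ n → 2 ^ (n ∸ m) * 2 ^ suc m ≡ 2 ^ suc n
2^[n∸m]*2^[1+m]≡2^[1+n] {m} {n} m≤n = begin
  2 ^ (n ∸ m) * 2 ^ suc m   ≡⟨ ℕP.^-distribˡ-+-* 2 (n ∸ m) (suc m) ⟨
  2 ^ (n ∸ m + suc m)       ≡⟨ cong (2 ^_) (ℕP.+-suc (n ∸ m) m) ⟩
  2 ^ suc (n ∸ m + m)       ≡⟨ cong (λ k → 2 ^ suc k) (ℕP.m∸n+n≡m m≤n) ⟩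
  2 ^ suc n                 ∎
  where open ≡-Reasoning

log₂-bracket : ∀ n → 0 < n → ∃ λ k → 2 ^ k ≤ n × n < 2 ^ suc k
log₂-bracket (suc zero)    _ = 0 , ℕP.≤-refl , s≤s (s≤s z≤n)
log₂-bracket (suc (suc n)) _ with log₂-bracket (suc n) (s≤s z≤n)
... | k , lo , hi with suc (suc n) <? 2 ^ suc k
...   | yes below    = k , ℕP.m≤n⇒m≤1+n lo , below
...   | no  notBelow = suc k , ℕP.≮⇒≥ notBelow ,
                       ℕP.≤-<-trans hi (ℕP.^-monoʳ-< 2 (s≤s (s≤s z≤n)) (ℕP.n<1+n (suc k)))

prefix-of-no-longer : ∀ {A : Set} {xs ys : List A} → Prefix _≡_ xs ys → length ys ≤ length xs → Prefix _≡_ ys xs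
prefix-of-no-longer {ys = []}    []         _        = []
prefix-of-no-longer {ys = _ ∷ _} []         ()
prefix-of-no-longer              (refl ∷ p) (s≤s le) = refl ∷ prefix-of-no-longer p le

Incident : (G : Graph) → Fin (n G) → Fin (m G) → Set
Incident G u e = proj₁ (edge G e) ≡ u ⊎ proj₂ (edge G e) ≡ u

incident? : ∀ G u e → Dec (Incident G u e)
incident? G u e = (proj₁ (edge G e) Fin.≟ u) ⊎-dec (proj₂ (edge G e) Fin.≟ u)

adjacent? : ∀ G e e′ → Dec (Adjacent G e e′)
adjacent? G e e′ =
  (p₁ e Fin.≟ p₁ e′) ⊎-dec (p₁ e Fin.≟ p₂ e′) ⊎-dec (p₂ e Fin.≟ p₁ e′) ⊎-dec (p₂ e Fin.≟ p₂ e′)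
  where
  p₁ p₂ : Fin (m G) → Fin (n G)
  p₁ = proj₁ ∘ edge G
  p₂ = proj₂ ∘ edge G

Adjacent-sym : ∀ {G e e′} → Adjacent G e e′ → Adjacent G e′ e
Adjacent-sym (inj₁ eq)               = inj₁ (sym eq)
Adjacent-sym (inj₂ (inj₁ eq))        = inj₂ (inj₂ (inj₁ (sym eq)))
Adjacent-sym (inj₂ (inj₂ (inj₁ eq))) = inj₂ (inj₁ (sym eq))
Adjacent-sym (inj₂ (inj₂ (inj₂ eq))) = inj₂ (inj₂ (inj₂ (sym eq)))

incident⇒adjacent : ∀ {G u e e′} → Incident G u e → Incident G u e′ → Adjacent G e e′
incident⇒adjacent (inj₁ x) (inj₁ y) = inj₁ (trans x (sym y))
incident⇒adjacent (inj₁ x) (inj₂ y) = inj₂ (inj₁ (trans x (sym y)))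
incident⇒adjacent (inj₂ x) (inj₁ y) = inj₂ (inj₂ (inj₁ (trans x (sym y))))
incident⇒adjacent (inj₂ x) (inj₂ y) = inj₂ (inj₂ (inj₂ (trans x (sym y))))

adjacent⇒incident : ∀ {G e e′} → Adjacent G e e′ →
                    Incident G (proj₁ (edge G e)) e′ ⊎ Incident G (proj₂ (edge G e)) e′
adjacent⇒incident (inj₁ eq)               = inj₁ (inj₁ (sym eq))
adjacent⇒incident (inj₂ (inj₁ eq))        = inj₁ (inj₂ (sym eq))
adjacent⇒incident (inj₂ (inj₂ (inj₁ eq))) = inj₂ (inj₁ (sym eq))
adjacent⇒incident (inj₂ (inj₂ (inj₂ eq))) = inj₂ (inj₂ (sym eq))

matching-incident-unique : ∀ {G M u e e′} → IsMatching G M → M e ≡ true → M e′ ≡ true →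
                           Incident G u e → Incident G u e′ → e ≡ e′
matching-incident-unique {G} {e = e} {e′} matching Me Me′ ue ue′ with e Fin.≟ e′
... | yes e≡e′ = e≡e′
... | no  e≢e′ = ⊥-elim (matching e e′ Me Me′ e≢e′ (incident⇒adjacent {G} ue ue′))

matchingSum : (G : Graph) → EdgeSet G → (Fin (m G) → ℕ) → ℕ
matchingSum G M g = sum (λ e → if M e then g e else 0)

matchingSum-indicator≤ : ∀ G M (g : Fin (m G) → ℕ) e → matchingSum G M (λ e′ → indicator e e′ * g e′) ≤ g e
matchingSum-indicator≤ G M g e = ℕP.≤-pred (sum<-singleSupport _ (s≤s z≤n) term< single)
  where
  term< : ∀ e′ → (if M e′ then indicator e e′ * g e′ else 0) < suc (g e)
  term< e′ with M e′ | e Fin.≟ e′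
  ... | true  | yes refl = s≤s (ℕP.≤-reflexive (ℕP.+-identityʳ (g e)))
  ... | true  | no  _    = s≤s z≤n
  ... | false | _        = s≤s z≤n
  nonzero⇒e : ∀ e′ → (if M e′ then indicator e e′ * g e′ else 0) ≢ 0 → e ≡ e′
  nonzero⇒e e′ nz with M e′ | e Fin.≟ e′
  ... | true  | yes e≡e′ = e≡e′
  ... | true  | no  _    = ⊥-elim (nz refl)
  ... | false | _        = ⊥-elim (nz refl)
  single : ∀ e₁ e₂ → _ ≢ 0 → _ ≢ 0 → e₁ ≡ e₂
  single e₁ e₂ nz₁ nz₂ = trans (sym (nonzero⇒e e₁ nz₁)) (nonzero⇒e e₂ nz₂)

matchingValue-scaled : ∀ I c (a : Fin (m (graph I)) → ℕ) M →
  matchingValue I (λ e → c ℚ.* natℚ (a e)) M ≡ c ℚ.* natℚ (matchingSum (graph I) M (λ e → a e * freq I e))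
matchingValue-scaled I c a M = trans (sumℚ-cong (m (graph I)) term≡) (sumℚ-scale-natℚ (m (graph I)) c _)
  where
  term≡ : ∀ e → (if M e then c ℚ.* natℚ (a e) ℚ.* natℚ (freq I e) else 0ℚ) ≡
                c ℚ.* natℚ (if M e then a e * freq I e else 0)
  term≡ e with M e
  ... | true  = trans (ℚP.*-assoc c _ _) (cong (c ℚ.*_) (sym (natℚ-homo-* (a e) (freq I e))))
  ... | false = sym (ℚP.*-zeroʳ c)

density⇒weightedMatching⁺ : ∀ {I} → PolyDensityAtMostQuarter I → (a : Fin (m (graph I)) → ℕ) →
  ∀ {W} → sum a ≡ suc W →
  ∃ λ M → IsMatching (graph I) M × 4 * suc W ≤ matchingSum (graph I) M (λ e → a e * freq I e)
density⇒weightedMatching⁺ {I} density a {W} Σa≡ = M , matching , natℚ-cancel-≤ (begin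
  natℚ (4 * suc W)   ≡⟨ natℚ-homo-* 4 (suc W) ⟩
  natℚ 4 ℚ.* w       ≤⟨ ℚP.*-monoʳ-≤-nonNeg w (subst (natℚ 4 ℚ.≤_) (matchingValue-scaled I c a M) 4≤value) ⟩
  c ℚ.* natℚ X ℚ.* w ≡⟨ *-cancel-inverse c w (natℚ X) (ℚP.*-inverseˡ w) ⟩
  natℚ X             ∎)
  where
  open ℚP.≤-Reasoning
  w : ℚ
  w = natℚ (suc W)
  instance
    w-positive : ℚ.Positive w
    w-positive = ℚP.normalize-pos (suc W) 1
    w-nonNeg : ℚ.NonNegative w
    w-nonNeg = ℚP.pos⇒nonNeg w
    w-nonZero : ℚ.NonZero w
    w-nonZero = ℚP.pos⇒nonZero w
    1/w-nonNeg : ℚ.NonNegative (1/ w)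
    1/w-nonNeg = ℚP.pos⇒nonNeg (1/ w) {{ℚP.1/pos⇒pos w}}
  c : ℚ
  c = 1/ w
  z : Fin (m (graph I)) → ℚ
  z e = c ℚ.* natℚ (a e)
  z-weighting : IsWeighting (graph I) z
  z-weighting = z≥0 , z≤1 , Σz≡1
    where
    z≥0 : ∀ e → 0ℚ ℚ.≤ z e
    z≥0 e = ℚP.nonNegative⁻¹ (z e) {{ℚP.nonNeg*nonNeg⇒nonNeg c (natℚ (a e)) {{ℚP.normalize-nonNeg (a e) 1}}}}
    z≤1 : ∀ e → z e ℚ.≤ 1ℚ
    z≤1 e = ℚP.≤-trans (ℚP.*-monoˡ-≤-nonNeg c (natℚ-mono-≤ (subst (a e ≤_) Σa≡ (≤-sum a e))))
                       (ℚP.≤-reflexive (ℚP.*-inverseˡ w))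
    Σz≡1 : sumℚ (m (graph I)) z ≡ 1ℚ
    Σz≡1 = trans (sumℚ-scale-natℚ (m (graph I)) c a) (trans (cong (λ s → c ℚ.* natℚ s) Σa≡) (ℚP.*-inverseˡ w))
  chosen : ∃ λ M → IsMaximalMatching (graph I) M × natℚ 4 ℚ.≤ matchingValue I z M
  chosen = density z z-weighting
  M : EdgeSet (graph I)
  M = proj₁ chosen
  matching : IsMatching (graph I) M
  matching = proj₁ (proj₁ (proj₂ chosen))
  4≤value : natℚ 4 ℚ.≤ matchingValue I z M
  4≤value = proj₂ (proj₂ chosen)
  X : ℕ
  X = matchingSum (graph I) M (λ e → a e * freq I e)

density⇒weightedMatching : ∀ {I} → PolyDensityAtMostQuarter I → (a : Fin (m (graph I)) → ℕ) →
  ∃ λ M → IsMatching (graph I) M × 4 * sum a ≤ matchingSum (graph I) M (λ e → a e * freq I e)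
density⇒weightedMatching {I} density a with sum a in Σa≡
... | zero  = (λ _ → false) , (λ _ _ ()) , z≤n
... | suc W = density⇒weightedMatching⁺ {I} density a Σa≡

-- For |s| ≤ k, cost k (just s) is the number of words of length k extending s.
cost : ℕ → Maybe (List Parity) → ℕ
cost k nothing  = 0
cost k (just s) = 2 ^ (k ∸ length s)

weight : ∀ {n} → ℕ → (Fin n → Maybe (List Parity)) → ℕ
weight k x = sum (cost k ∘ x)

branch : Parity → Maybe (List Parity) → Maybe (List Parity)
branch 0ℙ (just (0ℙ ∷ s)) = just s
branch 1ℙ (just (1ℙ ∷ s)) = just s
branch _  _               = nothing

branch-∷ : ∀ p s → branch p (just (p ∷ s)) ≡ just s
branch-∷ 0ℙ s = refl
branch-∷ 1ℙ s = refl

cost-branch : ∀ k o → cost k (branch 0ℙ o) + cost k (branch 1ℙ o) ≤ cost (suc k) o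
cost-branch k nothing         = z≤n
cost-branch k (just [])       = z≤n
cost-branch k (just (0ℙ ∷ s)) = ℕP.≤-reflexive (ℕP.+-identityʳ _)
cost-branch k (just (1ℙ ∷ s)) = ℕP.≤-refl

weight-branch : ∀ {n} k (x : Fin n → Maybe (List Parity)) →
                weight k (branch 0ℙ ∘ x) + weight k (branch 1ℙ ∘ x) ≤ weight (suc k) x
weight-branch k x = ℕP.≤-trans
  (ℕP.≤-reflexive (sym (∑-distrib-+ (cost k ∘ branch 0ℙ ∘ x) (cost k ∘ branch 1ℙ ∘ x))))
  (sum-mono-≤ (cost-branch k ∘ x))

lighter : ∀ {n} → ℕ → (Fin n → Maybe (List Parity)) → Parity
lighter k x with weight k (branch 0ℙ ∘ x) ≤? weight k (branch 1ℙ ∘ x)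
... | yes _ = 0ℙ
... | no  _ = 1ℙ

weight-lighter : ∀ {n} k (x : Fin n → Maybe (List Parity)) →
                 2 * weight k (branch (lighter k x) ∘ x) ≤ weight k (branch 0ℙ ∘ x) + weight k (branch 1ℙ ∘ x)
weight-lighter k x with weight k (branch 0ℙ ∘ x) ≤? weight k (branch 1ℙ ∘ x)
... | yes w₀≤w₁ = m≤n⇒2*m≤m+n w₀≤w₁
... | no  w₀≰w₁ = subst (2 * w₁ ≤_) (ℕP.+-comm w₁ _) (m≤n⇒2*m≤m+n (ℕP.<⇒≤ (ℕP.≰⇒> w₀≰w₁)))
  where
  w₁ : ℕ
  w₁ = weight k (branch 1ℙ ∘ x)

avoid : ∀ {n} → ℕ → (Fin n → Maybe (List Parity)) → List Parity
avoid zero    x = []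
avoid (suc k) x = lighter k x ∷ avoid k (branch (lighter k x) ∘ x)

avoid-length : ∀ {n} k (x : Fin n → Maybe (List Parity)) → length (avoid k x) ≡ k
avoid-length zero    x = refl
avoid-length (suc k) x = cong suc (avoid-length k _)

cost≤weight : ∀ {n} k (x : Fin n → Maybe (List Parity)) {i s} → x i ≡ just s → 2 ^ (k ∸ length s) ≤ weight k x
cost≤weight k x {i} xᵢ≡s = subst (λ o → cost k o ≤ weight k x) xᵢ≡s (≤-sum (cost k ∘ x) i)

-- Kraft: descending into the lighter branch keeps the weight below 2^k.
avoid-unprefixed : ∀ {n} k (x : Fin n → Maybe (List Parity)) → weight k x < 2 ^ k →
                   ∀ i {s} → x i ≡ just s → ¬ Prefix _≡_ s (avoid k x)
avoid-unprefixed zero x w<1 i {s} xᵢ≡s _ =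
  ℕP.<-irrefl refl (ℕP.<-≤-trans w<1
    (subst (λ d → 2 ^ d ≤ weight 0 x) (ℕP.0∸n≡0 (length s)) (cost≤weight 0 x xᵢ≡s)))
avoid-unprefixed (suc k) x w< i {[]} xᵢ≡s _ =
  ℕP.<-irrefl refl (ℕP.<-≤-trans w< (cost≤weight (suc k) x xᵢ≡s))
avoid-unprefixed (suc k) x w< i {q ∷ s} xᵢ≡s (refl ∷ s≼c) =
  avoid-unprefixed k (branch q ∘ x) w′< i (trans (cong (branch q) xᵢ≡s) (branch-∷ q s)) s≼c
  where
  w′< : weight k (branch q ∘ x) < 2 ^ k
  w′< = ℕP.*-cancelˡ-< 2 _ _ (ℕP.≤-<-trans (weight-lighter k x) (ℕP.≤-<-trans (weight-branch k x) w<))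

digits : ℕ → ℕ → List Parity
digits zero    t = []
digits (suc k) t = parity t ∷ digits k ⌊ t /2⌋

digits-prefix : ∀ {j k} → j ≤ k → ∀ t → Prefix _≡_ (digits j t) (digits k t)
digits-prefix z≤n       t = []
digits-prefix (s≤s j≤k) t = refl ∷ digits-prefix j≤k ⌊ t /2⌋

parity-adjust : ∀ t p → ∃ λ δ → δ ≤ 1 × parity (t + δ) ≡ p
parity-adjust zero          0ℙ = 0 , z≤n , refl
parity-adjust zero          1ℙ = 1 , s≤s z≤n , refl
parity-adjust (suc zero)    0ℙ = 1 , s≤s z≤n , refl
parity-adjust (suc zero)    1ℙ = 0 , z≤n , refl
parity-adjust (suc (suc t)) p  = parity-adjust t p

parity-even+ : ∀ j s → parity (j * 2 + s) ≡ parity s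
parity-even+ zero    s = refl
parity-even+ (suc j) s = parity-even+ j s

⌊even+/2⌋ : ∀ j s → ⌊ j * 2 + s /2⌋ ≡ j + ⌊ s /2⌋
⌊even+/2⌋ zero    s = refl
⌊even+/2⌋ (suc j) s = cong suc (⌊even+/2⌋ j s)

digits-window : ∀ c t → ∃ λ i → i < 2 ^ length c × digits (length c) (t + i) ≡ c
digits-window []      t = 0 , s≤s z≤n , refl
digits-window (p ∷ c) t with parity-adjust t p
... | δ , δ≤1 , parity≡p with digits-window c ⌊ t + δ /2⌋
... | j , j<2^ , digits≡c = j * 2 + δ , m<n∧δ≤1⇒m*2+δ<2*n j<2^ δ≤1 , (begin
  digits (suc (length c)) (t + (j * 2 + δ))
    ≡⟨ cong (digits (suc (length c))) (x∙yz≈y∙xz t (j * 2) δ) ⟩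
  parity (j * 2 + (t + δ)) ∷ digits (length c) ⌊ j * 2 + (t + δ) /2⌋
    ≡⟨ cong₂ _∷_ (trans (parity-even+ j (t + δ)) parity≡p)
                 (cong (digits (length c)) (trans (⌊even+/2⌋ j (t + δ)) (ℕP.+-comm j _))) ⟩
  p ∷ digits (length c) (⌊ t + δ /2⌋ + j)
    ≡⟨ cong (p ∷_) digits≡c ⟩
  p ∷ c ∎)
  where open ≡-Reasoning

PrefixFree : (G : Graph) → (Fin (m G) → List Parity) → Set
PrefixFree G code = ∀ e e′ → e ≢ e′ → Adjacent G e e′ → ¬ Prefix _≡_ (code e) (code e′)

-- Edge e is served at the times t ≡ code e (mod 2^|code e|), reading code e in binary.
codeSchedule : (G : Graph) → (Fin (m G) → List Parity) → Schedule G
codeSchedule G code t e = does (≡-dec ℙP._≟_ (code e) (digits (length (code e)) t))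

module _ (G : Graph) (code : Fin (m G) → List Parity) where

  served⇒digits : ∀ {t e} → codeSchedule G code t e ≡ true → code e ≡ digits (length (code e)) t
  served⇒digits {t} {e} _ with ≡-dec ℙP._≟_ (code e) (digits (length (code e)) t)
  served⇒digits _  | yes c≡digits = c≡digits
  served⇒digits () | no  _

  served-prefix : ∀ {t e e′} → codeSchedule G code t e ≡ true → codeSchedule G code t e′ ≡ true →
                  length (code e) ≤ length (code e′) → Prefix _≡_ (code e) (code e′)
  served-prefix {t} served served′ le =
    subst₂ (Prefix _≡_) (sym (served⇒digits served)) (sym (served⇒digits served′)) (digits-prefix le t)

  codeSchedule-matching : PrefixFree G code → ∀ t → IsMatching G (codeSchedule G code t)
  codeSchedule-matching prefixFree t e e′ served served′ e≢e′ adj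
    with ℕP.≤-total (length (code e)) (length (code e′))
  ... | inj₁ le = prefixFree e e′ e≢e′ adj (served-prefix served served′ le)
  ... | inj₂ ge = prefixFree e′ e (≢-sym e≢e′) (Adjacent-sym {G} adj) (served-prefix served′ served ge)

  codeSchedule-recurrence : ∀ e → RecurrenceAtMost G (codeSchedule G code) e (2 ^ length (code e))
  codeSchedule-recurrence e d t missed with digits-window (code e) t
  ... | i , i<2^ , hit = ℕP.≤-trans (s≤s (ℕP.≮⇒≥ i≮d)) i<2^
    where
    i≮d : ¬ i < d
    i≮d i<d = not-¬ (dec-true (≡-dec ℙP._≟_ (code e) _) (sym hit)) (missed i i<d)

codeSchedule-valid : ∀ I (code : Fin (m (graph I)) → List Parity) → PrefixFree (graph I) code →
                     (∀ e → 2 ^ length (code e) ≤ freq I e) → ValidSchedule I (codeSchedule (graph I) code)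
codeSchedule-valid I code prefixFree fits =
  codeSchedule-matching (graph I) code prefixFree ,
  λ e d t missed → ℕP.≤-trans (codeSchedule-recurrence (graph I) code e d t missed) (fits e)

module _ {E A : Set} (rank : E → ℕ) (init : A) (step : (E → A) → E → A) where

  private
    stage : ℕ → E → A
    stage zero    e = init
    stage (suc N) e with rank e ℕ.≟ N
    ... | yes _ = step (stage N) e
    ... | no  _ = stage N e

  byRank : E → A
  byRank e = step (stage (rank e)) e

  private
    stage-stable : ∀ N e → rank e < N → stage N e ≡ byRank e
    stage-stable (suc N) e r<1+N with rank e ℕ.≟ N
    ... | yes r≡N = cong (λ k → step (stage k) e) (sym r≡N)
    ... | no  r≢N = stage-stable N e (ℕP.≤∧≢⇒< (ℕP.≤-pred r<1+N) r≢N)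

  byRank-unfold : ∀ e → ∃ λ σ → (∀ e′ → rank e′ < rank e → σ e′ ≡ byRank e′) × byRank e ≡ step σ e
  byRank-unfold e = stage (rank e) , stage-stable (rank e) , refl

lexRank : ∀ {n} → (Fin n → ℕ) → Fin n → ℕ
lexRank {n} k i = k i * n + toℕ i

module _ {n} (k : Fin n → ℕ) where

  lexRank-mono : ∀ {i j} → k i < k j → lexRank k i < lexRank k j
  lexRank-mono {i} {j} kᵢ<kⱼ = begin-strict
    k i * n + toℕ i   <⟨ ℕP.+-monoʳ-< (k i * n) (FinP.toℕ<n i) ⟩
    k i * n + n       ≡⟨ ℕP.+-comm (k i * n) n ⟩
    suc (k i) * n     ≤⟨ ℕP.*-monoˡ-≤ n kᵢ<kⱼ ⟩
    k j * n           ≤⟨ ℕP.m≤m+n (k j * n) (toℕ j) ⟩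
    k j * n + toℕ j   ∎
    where open ℕP.≤-Reasoning

  lexRank-<⇒≤ : ∀ {i j} → lexRank k i < lexRank k j → k i ≤ k j
  lexRank-<⇒≤ {i} {j} rᵢ<rⱼ with k i ≤? k j
  ... | yes kᵢ≤kⱼ = kᵢ≤kⱼ
  ... | no  kᵢ≰kⱼ = ⊥-elim (ℕP.<-asym rᵢ<rⱼ (lexRank-mono (ℕP.≰⇒> kᵢ≰kⱼ)))

  lexRank-injective : ∀ {i j} → lexRank k i ≡ lexRank k j → i ≡ j
  lexRank-injective {i} {j} rᵢ≡rⱼ with ℕP.<-cmp (k i) (k j)
  ... | tri< kᵢ<kⱼ _ _ = ⊥-elim (ℕP.<-irrefl rᵢ≡rⱼ (lexRank-mono kᵢ<kⱼ))
  ... | tri> _ _ kⱼ<kᵢ = ⊥-elim (ℕP.<-irrefl (sym rᵢ≡rⱼ) (lexRank-mono kⱼ<kᵢ))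
  ... | tri≈ _ kᵢ≡kⱼ _ = FinP.toℕ-injective (ℕP.+-cancelˡ-≡ (k i * n) (toℕ i) (toℕ j)
                           (trans rᵢ≡rⱼ (cong (λ l → l * n + toℕ j) (sym kᵢ≡kⱼ))))

module Construction {I : DPS} (density : PolyDensityAtMostQuarter I) where

  private
    G : Graph
    G = graph I
    E : Set
    E = Fin (m G)
    f : E → ℕ
    f = freq I

  freq≥4 : ∀ e → 4 ≤ f e
  freq≥4 e with density⇒weightedMatching {I} density (indicator e)
  ... | M , _ , 4Σ≤X = begin
    4                                               ≤⟨ ℕP.*-monoʳ-≤ 4 1≤Σ ⟩
    4 * sum (indicator e)                           ≤⟨ 4Σ≤X ⟩
    matchingSum G M (λ e′ → indicator e e′ * f e′)  ≤⟨ matchingSum-indicator≤ G M f e ⟩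
    f e                                             ∎
    where
    open ℕP.≤-Reasoning
    1≤Σ : 1 ≤ sum (indicator e)
    1≤Σ = subst (_≤ sum (indicator e)) (indicator-self e) (≤-sum (indicator e) e)

  private
    bracket : ∀ e → ∃ λ k → 2 ^ k ≤ f e × f e < 2 ^ suc k
    bracket e = log₂-bracket (f e) (ℕP.<-≤-trans (s≤s z≤n) (freq≥4 e))

  level : E → ℕ
  level = proj₁ ∘ bracket

  2^level≤freq : ∀ e → 2 ^ level e ≤ f e
  2^level≤freq = proj₁ ∘ proj₂ ∘ bracket

  freq<2^[1+level] : ∀ e → f e < 2 ^ suc (level e)
  freq<2^[1+level] = proj₂ ∘ proj₂ ∘ bracket

  load : Fin (n G) → ℕ → E → ℕ
  load u K e with incident? G u e ×-dec level e ≤? K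
  ... | yes _ = 2 ^ (K ∸ level e)
  ... | no  _ = 0

  load-incident : ∀ {u K e} → Incident G u e → level e ≤ K → load u K e ≡ 2 ^ (K ∸ level e)
  load-incident {u} {K} {e} ue le with incident? G u e ×-dec level e ≤? K
  ... | yes _   = refl
  ... | no  ¬ue = ⊥-elim (¬ue (ue , le))

  matchingLoad< : ∀ {M} → IsMatching G M → ∀ u K → matchingSum G M (λ e → load u K e * f e) < 2 ^ suc K
  matchingLoad< {M} matching u K = sum<-singleSupport _ (ℕP.m^n>0 2 (suc K)) term< single
    where
    term< : ∀ e → (if M e then load u K e * f e else 0) < 2 ^ suc K
    term< e with M e | incident? G u e ×-dec level e ≤? K
    ... | true  | yes (_ , le) = subst (2 ^ (K ∸ level e) * f e <_) (2^[n∸m]*2^[1+m]≡2^[1+n] le)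
                                   (ℕP.*-monoʳ-< (2 ^ (K ∸ level e)) {{ℕP.m^n≢0 2 (K ∸ level e)}} (freq<2^[1+level] e))
    ... | true  | no  _        = ℕP.m^n>0 2 (suc K)
    ... | false | _            = ℕP.m^n>0 2 (suc K)
    nonzero⇒ : ∀ e → (if M e then load u K e * f e else 0) ≢ 0 → M e ≡ true × Incident G u e
    nonzero⇒ e nz with M e | incident? G u e ×-dec level e ≤? K
    ... | true  | yes (ue , _) = refl , ue
    ... | true  | no  _        = ⊥-elim (nz refl)
    ... | false | _            = ⊥-elim (nz refl)
    single : ∀ e e′ → _ ≢ 0 → _ ≢ 0 → e ≡ e′
    single e e′ nz nz′ with nonzero⇒ e nz | nonzero⇒ e′ nz′
    ... | Me , ue | Me′ , ue′ = matching-incident-unique {G} matching Me Me′ ue ue′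

  load-budget : ∀ u K → 2 * sum (load u K) < 2 ^ K
  load-budget u K with density⇒weightedMatching {I} density (load u K)
  ... | M , matching , 4Σ≤X = ℕP.*-cancelˡ-< 2 _ _ (begin-strict
    2 * (2 * sum (load u K))                  ≡⟨ ℕP.*-assoc 2 2 (sum (load u K)) ⟨
    4 * sum (load u K)                        ≤⟨ 4Σ≤X ⟩
    matchingSum G M (λ e → load u K e * f e)  <⟨ matchingLoad< matching u K ⟩
    2 ^ suc K                                 ∎)
    where open ℕP.≤-Reasoning

  rank : E → ℕ
  rank = lexRank level

  blocked : (E → List Parity) → E → E → Maybe (List Parity)
  blocked σ e e′ with rank e′ <? rank e ×-dec adjacent? G e e′
  ... | yes _ = just (σ e′)
  ... | no  _ = nothing

  code : E → List Parity
  code = byRank rank [] (λ σ e → avoid (level e) (blocked σ e))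

  code-length : ∀ e → length (code e) ≡ level e
  code-length e = avoid-length (level e) _

  blocked-weight : ∀ σ e → (∀ e′ → rank e′ < rank e → σ e′ ≡ code e′) →
                   weight (level e) (blocked σ e) < 2 ^ level e
  blocked-weight σ e agree = ℕP.≤-<-trans
    (ℕP.≤-trans (sum-mono-≤ cost≤loads) (ℕP.≤-reflexive (∑-distrib-+ (load u K) (load v K))))
    (2*m<o∧2*n<o⇒m+n<o {sum (load u K)} {sum (load v K)} (load-budget u K) (load-budget v K))
    where
    u v : Fin (n G)
    u = proj₁ (edge G e)
    v = proj₂ (edge G e)
    K : ℕ
    K = level e
    earlier-cost : ∀ e′ → σ e′ ≡ code e′ → level e′ ≤ K → Adjacent G e e′ →
                   cost K (just (σ e′)) ≤ load u K e′ + load v K e′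
    earlier-cost e′ σe′≡ shorter adj rewrite σe′≡ | code-length e′ with adjacent⇒incident {G} adj
    ... | inj₁ ue′ = ℕP.≤-trans (ℕP.≤-reflexive (sym (load-incident ue′ shorter))) (ℕP.m≤m+n _ _)
    ... | inj₂ ve′ = ℕP.≤-trans (ℕP.≤-reflexive (sym (load-incident ve′ shorter))) (ℕP.m≤n+m _ _)
    cost≤loads : ∀ e′ → cost K (blocked σ e e′) ≤ load u K e′ + load v K e′
    cost≤loads e′ with rank e′ <? rank e ×-dec adjacent? G e e′
    ... | yes (earlier , adj) = earlier-cost e′ (agree e′ earlier) (lexRank-<⇒≤ level earlier) adj
    ... | no  _               = z≤n

  code-earlier : ∀ {e e′} → rank e′ < rank e → Adjacent G e e′ → ¬ Prefix _≡_ (code e′) (code e)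
  code-earlier {e} {e′} earlier adj with byRank-unfold rank [] (λ σ e → avoid (level e) (blocked σ e)) e
  ... | σ , agree , code≡ = subst (¬_ ∘ Prefix _≡_ (code e′)) (sym code≡)
          (avoid-unprefixed (level e) (blocked σ e) (blocked-weight σ e agree) e′ blocked≡)
    where
    blocked≡ : blocked σ e e′ ≡ just (code e′)
    blocked≡ with rank e′ <? rank e ×-dec adjacent? G e e′
    ... | yes _  = cong just (agree e′ earlier)
    ... | no  ¬p = ⊥-elim (¬p (earlier , adj))

  code-prefixFree : PrefixFree G code
  code-prefixFree e e′ e≢e′ adj c≼c′ with ℕP.<-cmp (rank e) (rank e′)
  ... | tri< r<r′ _ _ = code-earlier r<r′ (Adjacent-sym {G} adj) c≼c′
  ... | tri≈ _ r≡r′ _ = e≢e′ (lexRank-injective level r≡r′)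
  ... | tri> _ _ r′<r = code-earlier r′<r adj (prefix-of-no-longer c≼c′
          (subst₂ _≤_ (sym (code-length e′)) (sym (code-length e)) (lexRank-<⇒≤ level r′<r)))

  code-fits : ∀ e → 2 ^ length (code e) ≤ f e
  code-fits e = subst (λ k → 2 ^ k ≤ f e) (sym (code-length e)) (2^level≤freq e)

theorem2 : (I : DPS) → PolyDensityAtMostQuarter I → Schedulable I
theorem2 I density = codeSchedule (graph I) code , codeSchedule-valid I code code-prefixFree code-fits
  where open Construction {I} density
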